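{- For any $\mathbf{CL14}$-formula $F$: $\mathbf{CL14}\not\vdash F$ if and only if $\overline{\mathbf{CL14}}\vdash F$.
   Context: $\mathbf{CL14}$-formulas are built from infinitely many nonlogical elementary atoms $p,q,\dots$, logical atoms $\top,\bot$, $\neg$ applied only to nonlogical atoms, and connectives $\wedge,\vee,\curlywedge,\curlyvee,\vartriangle,\triangledown,\sqcap,\sqcup$ of any arity $n\ge2$ (no general atoms). For compound $F$, $\neg F$ abbreviates its De Morgan dual ($\neg\neg E=E$, $\neg\top=\bot$, $\neg\bot=\top$; $\neg$ interchanges $\wedge/\vee$, $\curlywedge/\curlyvee$, $\vartriangle/\triangledown$, $\sqcap/\sqcup$, negating components). An occurrence is surface if in the scope of no connectives other than $\neg,\wedge,\vee$, and semisurface if in the scope of no $\sqcap,\sqcup$. $F$ is quasielementary iff it contains no operators other than $\neg,\top,\bot,\wedge,\vee,\curlywedge,\curlyvee$. The quasielementarization $|F|$ replaces every sequential subformula ($E_1\vartriangle\dots\vartriangle E_n$ or $E_1\triangledown\dots\triangledown E_n$) by its head $E_1$, every $\sqcap$-subformula by $\top$ and every $\sqcup$-subformula by $\bot$. For quasielementary $F$, the elementarization $\|F\|$ replaces every $\curlywedge$-subformula by $\top$ and every $\curlyvee$-subformula by $\bot$; $F$ is stable iff $\|F\|$ is a classical tautology, instable otherwise. Below, $E_2\vartriangle\dots\vartriangle E_n$ (resp. $E_2\triangledown\dots\triangledown E_n$) means $E_2$ if $n=2$. $\mathbf{CL14}$ has the rules: ($\curlywedge$) $\vec H\mapsto F$,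 $F$ stable quasielementary, $\vec H$ the set of all results of replacing, in $F$, a surface occurrence of $E_1\curlywedge\dots\curlywedge E_n$ by some $E_i$ (possibly empty set); ($\curlyvee$) $H\mapsto F$, $F$ quasielementary, $H$ results from replacing a surface $E_1\curlyvee\dots\curlyvee E_n$ by some $E_i$; ($\vartriangle\sqcap$) $|F|,\vec H\mapsto F$, $F$ not quasielementary, $\vec H$ all results of replacing a semisurface $E_1\sqcap\dots\sqcap E_n$ by some $E_i$ and all results of replacing a semisurface $E_1\vartriangle E_2\vartriangle\dots\vartriangle E_n$ by $E_2\vartriangle\dots\vartriangle E_n$; ($\sqcup$) $H\mapsto F$, $H$ replaces a semisurface $E_1\sqcup\dots\sqcup E_n$ by some $E_i$; ($\triangledown$) $H\mapsto F$, $H$ replaces a semisurface $E_1\triangledown E_2\triangledown\dots\triangledown E_n$ by $E_2\triangledown\dots\triangledown E_n$. $\overline{\mathbf{CL14}}$ has the same language and the rules: ($\overline{\curlyvee}$) $\vec H\mapsto F$, $F$ instable quasielementary, $\vec H$ the set of all results of replacing a surface occurrence of $E_1\curlyvee\dots\curlyvee E_n$ in $F$ by some $E_i$ (possibly empty); ($\overline{\curlywedge}$) $H\mapsto F$, $F$ quasielementary, $H$ replaces a surface $E_1\curlywedge\dots\curlywedge E_n$ by some $E_i$; ($\overline{\triangledown\sqcup}$) $|F|,\vec H\mapsto F$, $F$ not quasielementary, $\vec H$ all results of replacing a semisurface $E_1\sqcup\dots\sqcup E_n$ by some $E_i$ and all results of replacing a semisurface $E_1\triangledown E_2\triangledown\dots\triangledown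 E_n$ by $E_2\triangledown\dots\triangledown E_n$; ($\overline{\sqcap}$) $H\mapsto F$, $H$ replaces a semisurface $E_1\sqcap\dots\sqcap E_n$ by some $E_i$; ($\overline{\vartriangle}$) $H\mapsto F$, $H$ replaces a semisurface $E_1\vartriangle E_2\vartriangle\dots\vartriangle E_n$ by $E_2\vartriangle\dots\vartriangle E_n$. In both systems a formula is provable iff it is derivable by the rules. -}

module Defs where

open import Data.Nat using (ℕ)
open import Data.Bool using (Bool; true; false; _∧_; _∨_; not)
open import Data.List using (List; []; _∷_)
open import Data.List.Membership.Propositional using (_∈_)
open import Data.List.Relation.Unary.All using (All)
open import Data.Product using (_×_)
open import Relation.Binary.PropositionalEquality using (_≡_)
open import Relation.Nullary using (¬_)

-- Connectives (each of any arity n ≥ 2)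
--   and/or        : ∧ , ∨        (parallel / classical)
--   pand/por      : ⋏ , ⋎        (\curlywedge, \curlyvee)
--   sand/sor      : △ , ▽        (sequential, \vartriangle, \triangledown)
--   cand/cor      : ⊓ , ⊔        (choice)

data Conn : Set where
  and or pand por sand sor cand cor : Conn

-- Formulas.  Atoms are indexed by ℕ (infinitely many nonlogical
-- elementary atoms); ¬ only applies to nonlogical atoms.
-- A compound formula  E₁ c E₂ c … c Eₙ  (n ≥ 2) is  op c E₁ E₂ [E₃,…,Eₙ].
data Formula : Set where
  atom  : ℕ → Formula
  natom : ℕ → Formula
  ⊤f ⊥f : Formula
  op    : Conn → Formula → Formula → List Formula → Formula

data Ctx : Set where
  hole   : Ctx
  first  : Conn → Ctx → Formula → List Formula → Ctx
  second : Conn → Formula → Ctx → List Formula → Ctx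
  later  : Conn → Formula → Formula → List Formula → Ctx → List Formula → Ctx

plug : Ctx → Formula → Formula
plug hole G = G
plug (first c C E₂ Es) G = op c (plug C G) E₂ Es
plug (second c E₁ C Es) G = op c E₁ (plug C G) Es
plug (later c E₁ E₂ bs C as) G = op c E₁ E₂ (bs Data.List.++ (plug C G ∷ as))
  where import Data.List

data Through (P : Conn → Set) : Ctx → Set where
  hole   : Through P hole
  first  : ∀ {c C E₂ Es} → P c → Through P C → Through P (first c C E₂ Es)
  second : ∀ {c E₁ C Es} → P c → Through P C → Through P (second c E₁ C Es)
  later  : ∀ {c E₁ E₂ bs C as} → P c → Through P C →
           Through P (later c E₁ E₂ bs C as)

data SurfaceConn : Conn → Set where
  and : SurfaceConn and
  or  : SurfaceConn or

data SemisurfaceConn : Conn → Set where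
  and  : SemisurfaceConn and
  or   : SemisurfaceConn or
  pand : SemisurfaceConn pand
  por  : SemisurfaceConn por
  sand : SemisurfaceConn sand
  sor  : SemisurfaceConn sor

Surface : Ctx → Set
Surface = Through SurfaceConn

Semisurface : Ctx → Set
Semisurface = Through SemisurfaceConn

data QEConn : Conn → Set where
  and  : QEConn and
  or   : QEConn or
  pand : QEConn pand
  por  : QEConn por

data Quasielementary : Formula → Set where
  atom  : ∀ {p} → Quasielementary (atom p)
  natom : ∀ {p} → Quasielementary (natom p)
  ⊤f    : Quasielementary ⊤f
  ⊥f    : Quasielementary ⊥f
  op    : ∀ {c E₁ E₂ Es} → QEConn c → Quasielementary E₁ → Quasielementary E₂ →
          All Quasielementary Es → Quasielementary (op c E₁ E₂ Es)

mutual
  qe : Formula → Formula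
  qe (atom p) = atom p
  qe (natom p) = natom p
  qe ⊤f = ⊤f
  qe ⊥f = ⊥f
  qe (op sand E₁ E₂ Es) = qe E₁
  qe (op sor E₁ E₂ Es) = qe E₁
  qe (op cand E₁ E₂ Es) = ⊤f
  qe (op cor E₁ E₂ Es) = ⊥f
  qe (op and E₁ E₂ Es) = op and (qe E₁) (qe E₂) (qeList Es)
  qe (op or E₁ E₂ Es) = op or (qe E₁) (qe E₂) (qeList Es)
  qe (op pand E₁ E₂ Es) = op pand (qe E₁) (qe E₂) (qeList Es)
  qe (op por E₁ E₂ Es) = op por (qe E₁) (qe E₂) (qeList Es)

  qeList : List Formula → List Formula
  qeList [] = []
  qeList (E ∷ Es) = qe E ∷ qeList Es

-- Elementarization ‖F‖ (intended for quasielementary F):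
-- every ⋏-subformula ↦ ⊤, every ⋎-subformula ↦ ⊥.
mutual
  elem : Formula → Formula
  elem (atom p) = atom p
  elem (natom p) = natom p
  elem ⊤f = ⊤f
  elem ⊥f = ⊥f
  elem (op pand E₁ E₂ Es) = ⊤f
  elem (op por E₁ E₂ Es) = ⊥f
  elem (op c E₁ E₂ Es) = op c (elem E₁) (elem E₂) (elemList Es)

  elemList : List Formula → List Formula
  elemList [] = []
  elemList (E ∷ Es) = elem E ∷ elemList Es

-- Other connectives
-- never occur in ‖F‖ for quasielementary F; they get the dummy value false.
mutual
  eval : (ℕ → Bool) → Formula → Bool
  eval v (atom p) = v p
  eval v (natom p) = not (v p)
  eval v ⊤f = true
  eval v ⊥f = false
  eval v (op and E₁ E₂ Es) = eval v E₁ ∧ eval v E₂ ∧ evalAll v Es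
  eval v (op or E₁ E₂ Es) = eval v E₁ ∨ eval v E₂ ∨ evalAny v Es
  eval v (op _ _ _ _) = false

  evalAll : (ℕ → Bool) → List Formula → Bool
  evalAll v [] = true
  evalAll v (E ∷ Es) = eval v E ∧ evalAll v Es

  evalAny : (ℕ → Bool) → List Formula → Bool
  evalAny v [] = false
  evalAny v (E ∷ Es) = eval v E ∨ evalAny v Es

Tautology : Formula → Set
Tautology F = ∀ (v : ℕ → Bool) → eval v F ≡ true

Stable : Formula → Set
Stable F = Tautology (elem F)

Instable : Formula → Set
Instable F = ¬ Stable F

tailOp : Conn → Formula → List Formula → Formula
tailOp c E₂ [] = E₂
tailOp c E₂ (E₃ ∷ Es) = op c E₂ E₃ Es

data CL14 : Formula → Set where
  r-pand : ∀ {F} → Quasielementary F → Stable F →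
    (∀ C E₁ E₂ Es → Surface C → F ≡ plug C (op pand E₁ E₂ Es) →
       ∀ {E} → E ∈ (E₁ ∷ E₂ ∷ Es) → CL14 (plug C E)) →
    CL14 F
  r-por : ∀ {C E₁ E₂ Es E} → Quasielementary (plug C (op por E₁ E₂ Es)) →
    Surface C → E ∈ (E₁ ∷ E₂ ∷ Es) → CL14 (plug C E) →
    CL14 (plug C (op por E₁ E₂ Es))
  r-sand-cand : ∀ {F} → ¬ Quasielementary F → CL14 (qe F) →
    (∀ C E₁ E₂ Es → Semisurface C → F ≡ plug C (op cand E₁ E₂ Es) →
       ∀ {E} → E ∈ (E₁ ∷ E₂ ∷ Es) → CL14 (plug C E)) →
    (∀ C E₁ E₂ Es → Semisurface C → F ≡ plug C (op sand E₁ E₂ Es) →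
       CL14 (plug C (tailOp sand E₂ Es))) →
    CL14 F
  r-cor : ∀ {C E₁ E₂ Es E} → Semisurface C → E ∈ (E₁ ∷ E₂ ∷ Es) →
    CL14 (plug C E) → CL14 (plug C (op cor E₁ E₂ Es))
  r-sor : ∀ {C E₁ E₂ Es} → Semisurface C →
    CL14 (plug C (tailOp sor E₂ Es)) → CL14 (plug C (op sor E₁ E₂ Es))

data CL14bar : Formula → Set where
  r-por : ∀ {F} → Quasielementary F → Instable F →
    (∀ C E₁ E₂ Es → Surface C → F ≡ plug C (op por E₁ E₂ Es) →
       ∀ {E} → E ∈ (E₁ ∷ E₂ ∷ Es) → CL14bar (plug C E)) →
    CL14bar F
  r-pand : ∀ {C E₁ E₂ Es E} → Quasielementary (plug C (op pand E₁ E₂ Es)) →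
    Surface C → E ∈ (E₁ ∷ E₂ ∷ Es) → CL14bar (plug C E) →
    CL14bar (plug C (op pand E₁ E₂ Es))
  r-sor-cor : ∀ {F} → ¬ Quasielementary F → CL14bar (qe F) →
    (∀ C E₁ E₂ Es → Semisurface C → F ≡ plug C (op cor E₁ E₂ Es) →
       ∀ {E} → E ∈ (E₁ ∷ E₂ ∷ Es) → CL14bar (plug C E)) →
    (∀ C E₁ E₂ Es → Semisurface C → F ≡ plug C (op sor E₁ E₂ Es) →
       CL14bar (plug C (tailOp sor E₂ Es))) →
    CL14bar F
  r-cand : ∀ {C E₁ E₂ Es E} → Semisurface C → E ∈ (E₁ ∷ E₂ ∷ Es) →
    CL14bar (plug C E) → CL14bar (plug C (op cand E₁ E₂ Es))
  r-sand : ∀ {C E₁ E₂ Es} → Semisurface C →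
    CL14bar (plug C (tailOp sand E₂ Es)) → CL14bar (plug C (op sand E₁ E₂ Es))

-- In both systems every rule either quantifies over all "environment" moves
-- (⋏-, ⊓-choices and △-tails in CL14; ⋎-, ⊔-choices and ▽-tails in the dual)
-- or picks one "machine" move, and the two systems swap these roles.
--
-- Exclusivity: by induction on a CL14‾-derivation, the only interesting cases
-- are those where CL14‾ makes an environment move of CL14.  These moves are
-- admissible in CL14, because a move at a connective c commutes with any move
-- at a connective d ≠ c: the two occurrences are nested or disjoint, and in
-- either case the two results can be brought together.
--
-- All occurrences of a connective
-- can be enumerated and stability is decidable, so the rule of one system
-- that quantifies over all moves at F either has all its premises, or fails at
-- one move, to which the single-move rule of the other system then applies.
module Submission where

open import Defs
open import Data.Bool using (Bool; true; false; not)
import Data.Bool as Bool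
open import Data.Empty using (⊥-elim)
open import Data.List using (List; []; _∷_; _++_; [_]; map)
open import Data.List.Membership.Propositional using (_∈_; _∉_)
open import Data.List.Membership.Propositional.Properties using (∈-++⁻; ∈-++⁺ˡ; ∈-++⁺ʳ; ∈-map⁺; ∈-map⁻)
open import Data.List.Properties using (++-assoc; ∷-injective; ++-identityʳ)
open import Data.List.Relation.Unary.All using (All; []; _∷_; lookup)
import Data.List.Relation.Unary.All.Properties as All
open import Data.List.Relation.Unary.Any using (here; there)
open import Data.Nat using (ℕ; suc; _+_; _≤_; _<_; _≟_; z≤n; s≤s)
open import Data.Nat.Induction using (<-wellFounded)
open import Data.Nat.Properties using (≤-refl; ≤-trans; ≤-<-trans; <⇒≤; m≤m+n; m≤n+m; m<n+m; +-mono-≤; +-monoˡ-<; +-monoʳ-<; +-mono-<-≤; +-mono-≤-<)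
open import Data.Product using (Σ; ∃-syntax; _×_; _,_; proj₁; proj₂)
open import Data.Sum using (_⊎_; inj₁; inj₂; [_,_]′; swap)
open import Function using (id)
import Induction.WellFounded as WellFounded
open import Level using (0ℓ)
open import Relation.Binary.Construct.On using (wellFounded)
open import Relation.Binary.PropositionalEquality using (_≡_; _≢_; refl; sym; trans; cong; cong₂; subst)
open import Relation.Nullary using (¬_; Dec; yes; no)
open import Relation.Nullary.Decidable using (map′)
open import Relation.Unary using (Decidable)

op-injective : ∀ {c c' : Conn} {E₁ E₁' E₂ E₂' : Formula} {Es Es' : List Formula} →
  op c E₁ E₂ Es ≡ op c' E₁' E₂' Es' → c ≡ c' × E₁ ≡ E₁' × E₂ ≡ E₂' × Es ≡ Es'
op-injective refl = refl , refl , refl , refl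

infixr 5 _⊙_
_⊙_ : Ctx → Ctx → Ctx
hole ⊙ D = D
first c C E₂ Es ⊙ D = first c (C ⊙ D) E₂ Es
second c E₁ C Es ⊙ D = second c E₁ (C ⊙ D) Es
later c E₁ E₂ bs C as ⊙ D = later c E₁ E₂ bs (C ⊙ D) as

plug-⊙ : ∀ C D Z → plug (C ⊙ D) Z ≡ plug C (plug D Z)
plug-⊙ hole D Z = refl
plug-⊙ (first c C E₂ Es) D Z = cong (λ x → op c x E₂ Es) (plug-⊙ C D Z)
plug-⊙ (second c E₁ C Es) D Z = cong (λ x → op c E₁ x Es) (plug-⊙ C D Z)
plug-⊙ (later c E₁ E₂ bs C as) D Z = cong (λ x → op c E₁ E₂ (bs ++ x ∷ as)) (plug-⊙ C D Z)

through-⊙ : ∀ {P C D} → Through P C → Through P D → Through P (C ⊙ D)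
through-⊙ hole t = t
through-⊙ (first p s) t = first p (through-⊙ s t)
through-⊙ (second p s) t = second p (through-⊙ s t)
through-⊙ (later p s) t = later p (through-⊙ s t)

through-⊙⁻ : ∀ {P} C {D} → Through P (C ⊙ D) → Through P D
through-⊙⁻ hole t = t
through-⊙⁻ (first c C E₂ Es) (first p t) = through-⊙⁻ C t
through-⊙⁻ (second c E₁ C Es) (second p t) = through-⊙⁻ C t
through-⊙⁻ (later c E₁ E₂ bs C as) (later p t) = through-⊙⁻ C t

quasielementary-plug⁻ : ∀ C {X} → Quasielementary (plug C X) → Quasielementary X
quasielementary-plug⁻ hole q = q
quasielementary-plug⁻ (first c C E₂ Es) (op _ q _ _) = quasielementary-plug⁻ C q
quasielementary-plug⁻ (second c E₁ C Es) (op _ _ q _) = quasielementary-plug⁻ C q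
quasielementary-plug⁻ (later c E₁ E₂ bs C as) (op _ _ _ qs) with All.++⁻ʳ bs qs
... | q ∷ _ = quasielementary-plug⁻ C q

quasielementary-plug : ∀ C {X Z} → Quasielementary (plug C X) → Quasielementary Z →
  Quasielementary (plug C Z)
quasielementary-plug hole q z = z
quasielementary-plug (first c C E₂ Es) (op k q q₂ qs) z = op k (quasielementary-plug C q z) q₂ qs
quasielementary-plug (second c E₁ C Es) (op k q₁ q qs) z = op k q₁ (quasielementary-plug C q z) qs
quasielementary-plug (later c E₁ E₂ bs C as) (op k q₁ q₂ qs) z with All.++⁻ bs qs
... | qbs , q ∷ qas = op k q₁ q₂ (All.++⁺ qbs (quasielementary-plug C q z ∷ qas))

-- Relative position of two occurrences

++-∷-cases : ∀ {A : Set} (bs : List A) x as bs' y as' → bs ++ x ∷ as ≡ bs' ++ y ∷ as' →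
  (bs ≡ bs' × x ≡ y × as ≡ as') ⊎
  (∃[ mid ] (bs' ≡ bs ++ x ∷ mid × as ≡ mid ++ y ∷ as')) ⊎
  (∃[ mid ] (bs ≡ bs' ++ y ∷ mid × as' ≡ mid ++ x ∷ as))
++-∷-cases [] x as [] y as' refl = inj₁ (refl , refl , refl)
++-∷-cases [] x as (b' ∷ bs') y as' refl = inj₂ (inj₁ (bs' , refl , refl))
++-∷-cases (b ∷ bs) x as [] y as' refl = inj₂ (inj₂ (bs , refl , refl))
++-∷-cases (b ∷ bs) x as (b' ∷ bs') y as' eq with ∷-injective eq
... | refl , eq' with ++-∷-cases bs x as bs' y as' eq'
... | inj₁ (refl , x≡y , as≡as') = inj₁ (refl , x≡y , as≡as')
... | inj₂ (inj₁ (mid , refl , e)) = inj₂ (inj₁ (mid , refl , e))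
... | inj₂ (inj₂ (mid , refl , e)) = inj₂ (inj₂ (mid , refl , e))

-- X at C and Y at D are disjoint occurrences of one formula: after replacing
-- Y by Y' (resp. X by X'), X sits at C' (resp. Y at D'), and both
-- replacements together give the same formula in either order.
Disjoint : Ctx → Ctx → Formula → Formula → Set₁
Disjoint C D X Y = ∀ X' Y' → Σ Ctx λ C' → Σ Ctx λ D' →
  (∀ {P} → Through P C → Through P D → Through P C' × Through P D') ×
  plug D Y' ≡ plug C' X × plug C X' ≡ plug D' Y × plug C' X' ≡ plug D' Y'

data Position (C D : Ctx) (X Y : Formula) : Set₁ where
  outer : ∀ D'' → D ≡ C ⊙ D'' → X ≡ plug D'' Y → Position C D X Y
  inner : ∀ C'' → C ≡ D ⊙ C'' → Y ≡ plug C'' X → Position C D X Y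
  apart : Disjoint C D X Y → Position C D X Y

disjoint-first : ∀ {C D X Y} c E₂ Es → Disjoint C D X Y →
  Disjoint (first c C E₂ Es) (first c D E₂ Es) X Y
disjoint-first c E₂ Es dj X' Y' with dj X' Y'
... | C' , D' , th , e₁ , e₂ , e₃ =
  first c C' E₂ Es , first c D' E₂ Es ,
  (λ { (first p t) (first q u) → first p (proj₁ (th t u)) , first q (proj₂ (th t u)) }) ,
  cong f e₁ , cong f e₂ , cong f e₃
  where
  f : Formula → Formula
  f x = op c x E₂ Es

disjoint-second : ∀ {C D X Y} c E₁ Es → Disjoint C D X Y →
  Disjoint (second c E₁ C Es) (second c E₁ D Es) X Y
disjoint-second c E₁ Es dj X' Y' with dj X' Y'
... | C' , D' , th , e₁ , e₂ , e₃ =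
  second c E₁ C' Es , second c E₁ D' Es ,
  (λ { (second p t) (second q u) → second p (proj₁ (th t u)) , second q (proj₂ (th t u)) }) ,
  cong f e₁ , cong f e₂ , cong f e₃
  where
  f : Formula → Formula
  f x = op c E₁ x Es

disjoint-later : ∀ {C D X Y} c E₁ E₂ bs as → Disjoint C D X Y →
  Disjoint (later c E₁ E₂ bs C as) (later c E₁ E₂ bs D as) X Y
disjoint-later c E₁ E₂ bs as dj X' Y' with dj X' Y'
... | C' , D' , th , e₁ , e₂ , e₃ =
  later c E₁ E₂ bs C' as , later c E₁ E₂ bs D' as ,
  (λ { (later p t) (later q u) → later p (proj₁ (th t u)) , later q (proj₂ (th t u)) }) ,
  cong f e₁ , cong f e₂ , cong f e₃
  where
  f : Formula → Formula
  f x = op c E₁ E₂ (bs ++ x ∷ as)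

disjoint-sym : ∀ {C D X Y} → Disjoint C D X Y → Disjoint D C Y X
disjoint-sym dj Y' X' with dj X' Y'
... | C' , D' , th , e₁ , e₂ , e₃ =
  D' , C' , (λ t u → proj₂ (th u t) , proj₁ (th u t)) , e₂ , e₁ , sym e₃

position-sym : ∀ {C D X Y} → Position C D X Y → Position D C Y X
position-sym (outer D'' e e') = inner D'' e e'
position-sym (inner C'' e e') = outer C'' e e'
position-sym (apart dj) = apart (disjoint-sym dj)

position-map : ∀ {C D X Y} (f : Ctx → Ctx) → (∀ K L → f (K ⊙ L) ≡ f K ⊙ L) →
  (Disjoint C D X Y → Disjoint (f C) (f D) X Y) → Position C D X Y → Position (f C) (f D) X Y
position-map {C} f f-⊙ g (outer D'' refl e) = outer D'' (f-⊙ C D'') e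
position-map {D = D} f f-⊙ g (inner C'' refl e) = inner C'' (f-⊙ D C'') e
position-map f f-⊙ g (apart dj) = apart (g dj)

siblings-first-second : ∀ c C D Es X Y →
  Disjoint (first c C (plug D Y) Es) (second c (plug C X) D Es) X Y
siblings-first-second c C D Es X Y X' Y' =
  first c C (plug D Y') Es , second c (plug C X') D Es ,
  (λ { (first p t) (second q u) → first p t , second q u }) , refl , refl , refl

siblings-first-later : ∀ c C D E₂ bs as X Y →
  Disjoint (first c C E₂ (bs ++ plug D Y ∷ as)) (later c (plug C X) E₂ bs D as) X Y
siblings-first-later c C D E₂ bs as X Y X' Y' =
  first c C E₂ (bs ++ plug D Y' ∷ as) , later c (plug C X') E₂ bs D as ,
  (λ { (first p t) (later q u) → first p t , later q u }) , refl , refl , refl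

siblings-second-later : ∀ c C D E₁ bs as X Y →
  Disjoint (second c E₁ C (bs ++ plug D Y ∷ as)) (later c E₁ (plug C X) bs D as) X Y
siblings-second-later c C D E₁ bs as X Y X' Y' =
  second c E₁ C (bs ++ plug D Y' ∷ as) , later c E₁ (plug C X') bs D as ,
  (λ { (second p t) (later q u) → second p t , later q u }) , refl , refl , refl

siblings-later-later : ∀ c C D E₁ E₂ bs mid as X Y →
  Disjoint (later c E₁ E₂ bs C (mid ++ plug D Y ∷ as))
           (later c E₁ E₂ (bs ++ plug C X ∷ mid) D as) X Y
siblings-later-later c C D E₁ E₂ bs mid as X Y X' Y' =
  later c E₁ E₂ bs C (mid ++ plug D Y' ∷ as) , later c E₁ E₂ (bs ++ plug C X' ∷ mid) D as ,
  (λ { (later p t) (later q u) → later p t , later q u }) ,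
  cong (op c E₁ E₂) (++-assoc bs (plug C X ∷ mid) (plug D Y' ∷ as)) ,
  cong (op c E₁ E₂) (sym (++-assoc bs (plug C X' ∷ mid) (plug D Y ∷ as))) ,
  cong (op c E₁ E₂) (sym (++-assoc bs (plug C X' ∷ mid) (plug D Y' ∷ as)))

position : ∀ C D X Y → plug C X ≡ plug D Y → Position C D X Y
position hole D X Y eq = outer D refl eq
position C hole X Y eq = inner C refl (sym eq)
position (first c C E₂ Es) (first c' D E₂' Es') X Y eq with op-injective eq
... | refl , e , refl , refl =
  position-map (λ K → first c K E₂ Es) (λ _ _ → refl) (disjoint-first c E₂ Es) (position C D X Y e)
position (second c E₁ C Es) (second c' E₁' D Es') X Y eq with op-injective eq
... | refl , refl , e , refl =
  position-map (λ K → second c E₁ K Es) (λ _ _ → refl) (disjoint-second c E₁ Es) (position C D X Y e)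
position (first c C E₂ Es) (second c' E₁' D Es') X Y eq with op-injective eq
... | refl , refl , refl , refl = apart (siblings-first-second c C D Es X Y)
position (second c E₁ C Es) (first c' D E₂' Es') X Y eq with op-injective eq
... | refl , refl , refl , refl = position-sym (apart (siblings-first-second c D C Es Y X))
position (first c C E₂ Es) (later c' E₁' E₂' bs D as) X Y eq with op-injective eq
... | refl , refl , refl , refl = apart (siblings-first-later c C D E₂ bs as X Y)
position (later c E₁ E₂ bs C as) (first c' D E₂' Es') X Y eq with op-injective eq
... | refl , refl , refl , refl = position-sym (apart (siblings-first-later c D C E₂ bs as Y X))
position (second c E₁ C Es) (later c' E₁' E₂' bs D as) X Y eq with op-injective eq
... | refl , refl , refl , refl = apart (siblings-second-later c C D E₁ bs as X Y)
position (later c E₁ E₂ bs C as) (second c' E₁' D Es') X Y eq with op-injective eq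
... | refl , refl , refl , refl = position-sym (apart (siblings-second-later c D C E₁ bs as Y X))
position (later c E₁ E₂ bs C as) (later c' E₁' E₂' bs' D as') X Y eq with op-injective eq
... | refl , refl , refl , e with ++-∷-cases bs (plug C X) as bs' (plug D Y) as' e
... | inj₁ (refl , e' , refl) =
  position-map (λ K → later c E₁ E₂ bs K as) (λ _ _ → refl) (disjoint-later c E₁ E₂ bs as)
               (position C D X Y e')
... | inj₂ (inj₁ (mid , refl , refl)) = apart (siblings-later-later c C D E₁ E₂ bs mid as' X Y)
... | inj₂ (inj₂ (mid , refl , refl)) =
  position-sym (apart (siblings-later-later c D C E₁ E₂ bs' mid as Y X))

data Kind : Set where
  choice tail : Kind

Result : Kind → Conn → Formula → Formula → List Formula → Formula → Set
Result choice c A₁ A₂ As X' = X' ∈ A₁ ∷ A₂ ∷ As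
Result tail c A₁ A₂ As X' = X' ≡ tailOp c A₂ As

data Move (P : Conn → Set) (c : Conn) (k : Kind) (F G : Formula) : Set where
  mv : ∀ C {A₁ A₂ As X'} → Through P C → F ≡ plug C (op c A₁ A₂ As) →
       Result k c A₁ A₂ As X' → G ≡ plug C X' → Move P c k F G

quasielementary-move : ∀ {P c F G} → Move P c choice F G → Quasielementary F → Quasielementary G
quasielementary-move (mv C t refl X'∈ refl) q with quasielementary-plug⁻ C q
... | op _ q₁ q₂ qs = quasielementary-plug C q (lookup (q₁ ∷ q₂ ∷ qs) X'∈)

-- Y occurs at D strictly inside the redex op c A₁ A₂ As of a move with
-- result X'.  Replacing Y by Y'' yields a redex whose corresponding result is
-- either X' itself or X' with that same replacement at D₃.
data Nested (P : Conn → Set) (k : Kind) (c : Conn) (X' : Formula) (D : Ctx) (Y Y'' : Formula) : Set where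
  discarded : ∀ {A₁ A₂ As} → plug D Y'' ≡ op c A₁ A₂ As → Result k c A₁ A₂ As X' →
              Nested P k c X' D Y Y''
  kept : ∀ {A₁ A₂ As} D₃ → plug D Y'' ≡ op c A₁ A₂ As → Through P D₃ →
         Result k c A₁ A₂ As (plug D₃ Y'') → X' ≡ plug D₃ Y → Nested P k c X' D Y Y''

nested : ∀ {P} k c {A₁ A₂ As X' Y} D → op c A₁ A₂ As ≢ Y → op c A₁ A₂ As ≡ plug D Y →
  Through P D → Result k c A₁ A₂ As X' → ∀ Y'' → Nested P k c X' D Y Y''
nested k c hole ne eq t r Y'' = ⊥-elim (ne eq)
nested choice c (first .c D E₂ Es) _ refl (first p t) (here refl) Y'' = kept D refl t (here refl) refl
nested choice c (first .c D E₂ Es) _ refl (first p t) (there m) Y'' = discarded refl (there m)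
nested tail c (first .c D E₂ Es) _ refl (first p t) r Y'' = discarded refl r
nested choice c (second .c E₁ D Es) _ refl (second p t) (here e) Y'' = discarded refl (here e)
nested choice c (second .c E₁ D Es) _ refl (second p t) (there (here refl)) Y'' =
  kept D refl t (there (here refl)) refl
nested choice c (second .c E₁ D Es) _ refl (second p t) (there (there m)) Y'' =
  discarded refl (there (there m))
nested tail c (second .c E₁ D []) _ refl (second p t) refl Y'' = kept D refl t refl refl
nested tail c (second .c E₁ D (A₃ ∷ As)) _ refl (second p t) refl Y'' =
  kept (first c D A₃ As) refl (first p t) refl refl
nested choice c (later .c E₁ E₂ bs D as) _ refl (later p t) (here e) Y'' = discarded refl (here e)
nested choice c (later .c E₁ E₂ bs D as) _ refl (later p t) (there (here e)) Y'' =
  discarded refl (there (here e))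
nested choice c (later .c E₁ E₂ bs D as) _ refl (later p t) (there (there m)) Y''
  with ∈-++⁻ bs m
... | inj₁ m' = discarded refl (there (there (∈-++⁺ˡ m')))
... | inj₂ (here refl) = kept D refl t (there (there (∈-++⁺ʳ bs (here refl)))) refl
... | inj₂ (there m') = discarded refl (there (there (∈-++⁺ʳ bs (there m'))))
nested tail c (later .c E₁ E₂ [] D as) _ refl (later p t) refl Y'' =
  kept (second c E₂ D as) refl (second p t) refl refl
nested tail c (later .c E₁ E₂ (b ∷ bs) D as) _ refl (later p t) refl Y'' =
  kept (later c E₂ b bs D as) refl (later p t) refl refl

data Diamond (P : Conn → Set) (c : Conn) (k : Kind) (d : Conn) (l : Kind) (H G : Formula) : Set where
  common   : ∀ {K} → Move P d l H K → Move P c k G K → Diamond P c k d l H G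
  forward  : Move P d l H G → Diamond P c k d l H G
  backward : Move P c k G H → Diamond P c k d l H G

diamond-sym : ∀ {P c k d l H G} → Diamond P d l c k G H → Diamond P c k d l H G
diamond-sym (common m m') = common m' m
diamond-sym (forward m) = backward m
diamond-sym (backward m) = forward m

diamond-nested : ∀ {P c d k l H G} C D'' {A₁ A₂ As X' B₁ B₂ Bs Y'} → c ≢ d →
  Through P C → Through P (C ⊙ D'') → op c A₁ A₂ As ≡ plug D'' (op d B₁ B₂ Bs) →
  Result k c A₁ A₂ As X' → Result l d B₁ B₂ Bs Y' → H ≡ plug C X' → G ≡ plug (C ⊙ D'') Y' →
  Diamond P c k d l H G
diamond-nested {k = k} C D'' {Y' = Y'} c≢d tc td e rc rd eH eG
  with nested k _ D'' (λ e → c≢d (proj₁ (op-injective e))) e (through-⊙⁻ C td) rc Y'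
... | discarded em r' = backward (mv C tc (trans eG (trans (plug-⊙ C D'' Y') (cong (plug C) em))) r' eH)
... | kept D₃ em t₃ r' e' =
  common (mv (C ⊙ D₃) (through-⊙ tc t₃) (trans eH (trans (cong (plug C) e') (sym (plug-⊙ C D₃ _)))) rd
             (sym (plug-⊙ C D₃ Y')))
         (mv C tc (trans eG (trans (plug-⊙ C D'' Y') (cong (plug C) em))) r' refl)

diamond : ∀ {P c d k l F H G} → c ≢ d → Move P c k F H → Move P d l F G → Diamond P c k d l H G
diamond c≢d (mv C {X' = X'} tc eF rc eH) (mv D {X' = Y'} td eF' rd eG)
  with position C D _ _ (trans (sym eF) eF')
... | outer D'' refl e = diamond-nested C D'' c≢d tc td e rc rd eH eG
... | inner C'' refl e = diamond-sym (diamond-nested D C'' (λ d≡c → c≢d (sym d≡c)) td tc e rd rc eG eH)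
... | apart dj with dj X' Y'
...   | C' , D' , th , e₁ , e₂ , e₃ =
  common (mv D' (proj₂ (th tc td)) (trans eH e₂) rd e₃) (mv C' (proj₁ (th tc td)) (trans eG e₁) rc refl)

data Environment : Conn → Kind → Set where
  cand : Environment cand choice
  sand : Environment sand tail

data Machine : Conn → Kind → Set where
  cor : Machine cor choice
  sor : Machine sor tail

environment-not-quasielementary : ∀ {c k A₁ A₂ As} → Environment c k →
  ¬ Quasielementary (op c A₁ A₂ As)
environment-not-quasielementary cand (op () _ _ _)
environment-not-quasielementary sand (op () _ _ _)

environment≢machine : ∀ {c k d l} → Environment c k → Machine d l → c ≢ d
environment≢machine cand cor ()
environment≢machine cand sor ()
environment≢machine sand cor ()
environment≢machine sand sor ()

CL14-por-move : ∀ {F G} → Move SurfaceConn por choice F G → Quasielementary F → CL14 G → CL14 F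
CL14-por-move (mv C t refl r refl) q d = r-por q t r d

CL14-machine-move : ∀ {c k F G} → Machine c k → Move SemisurfaceConn c k F G → CL14 G → CL14 F
CL14-machine-move cor (mv C t refl r refl) d = r-cor t r d
CL14-machine-move sor (mv C t refl refl refl) d = r-sor t d

CL14bar-pand-move : ∀ {F G} → Move SurfaceConn pand choice F G → Quasielementary F → CL14bar G → CL14bar F
CL14bar-pand-move (mv C t refl r refl) q d = r-pand q t r d

CL14bar-environment-move : ∀ {c k F G} → Environment c k → Move SemisurfaceConn c k F G →
  CL14bar G → CL14bar F
CL14bar-environment-move cand (mv C t refl r refl) d = r-cand t r d
CL14bar-environment-move sand (mv C t refl refl refl) d = r-sand t d

all-choices : ∀ {A : Formula → Set} {P c F} → (∀ {G} → Move P c choice F G → A G) →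
  ∀ C A₁ A₂ As → Through P C → F ≡ plug C (op c A₁ A₂ As) →
  ∀ {E} → E ∈ A₁ ∷ A₂ ∷ As → A (plug C E)
all-choices h C _ _ _ t e E∈ = h (mv C t e E∈ refl)

all-tails : ∀ {A : Formula → Set} {P c F} → (∀ {G} → Move P c tail F G → A G) →
  ∀ C A₁ A₂ As → Through P C → F ≡ plug C (op c A₁ A₂ As) → A (plug C (tailOp c A₂ As))
all-tails h C _ _ _ t e = h (mv C t e refl refl)

-- Exclusivity

CL14-pand-admissible : ∀ {F H} → CL14 F → Quasielementary F → Move SurfaceConn pand choice F H → CL14 H
CL14-pand-admissible (r-pand q s prem) _ (mv C t eF r refl) = prem C _ _ _ t eF r
CL14-pand-admissible (r-por {C} q t e d) qF m with diamond (λ ()) m (mv C t refl e refl)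
... | common mHK mGK =
  CL14-por-move mHK (quasielementary-move m qF)
    (CL14-pand-admissible d (quasielementary-move (mv C t refl e refl) qF) mGK)
... | forward mHG = CL14-por-move mHG (quasielementary-move m qF) d
... | backward mGH = CL14-pand-admissible d (quasielementary-move (mv C t refl e refl) qF) mGH
CL14-pand-admissible (r-sand-cand nq _ _ _) qF m = ⊥-elim (nq qF)
CL14-pand-admissible (r-cor {C} _ _ _) qF m with quasielementary-plug⁻ C qF
... | op () _ _ _
CL14-pand-admissible (r-sor {C} _ _) qF m with quasielementary-plug⁻ C qF
... | op () _ _ _

CL14-environment-admissible : ∀ {c k F H} → Environment c k → CL14 F →
  Move SemisurfaceConn c k F H → CL14 H
CL14-environment-admissible ev (r-pand q _ _) (mv C _ refl _ _) =
  ⊥-elim (environment-not-quasielementary ev (quasielementary-plug⁻ C q))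
CL14-environment-admissible ev (r-por q _ _ _) (mv C _ eF _ _) =
  ⊥-elim (environment-not-quasielementary ev (quasielementary-plug⁻ C (subst Quasielementary eF q)))
CL14-environment-admissible cand (r-sand-cand _ _ prem _) (mv C t eF r refl) = prem C _ _ _ t eF r
CL14-environment-admissible sand (r-sand-cand _ _ _ prem) (mv C t eF refl refl) = prem C _ _ _ t eF
CL14-environment-admissible ev (r-cor {C} t e d) m
  with diamond (environment≢machine ev cor) m (mv C t refl e refl)
... | common mHK mGK = CL14-machine-move cor mHK (CL14-environment-admissible ev d mGK)
... | forward mHG = CL14-machine-move cor mHG d
... | backward mGH = CL14-environment-admissible ev d mGH
CL14-environment-admissible ev (r-sor {C} t d) m
  with diamond (environment≢machine ev sor) m (mv C t refl refl refl)
... | common mHK mGK = CL14-machine-move sor mHK (CL14-environment-admissible ev d mGK)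
... | forward mHG = CL14-machine-move sor mHG d
... | backward mGH = CL14-environment-admissible ev d mGH

exclusive : ∀ {F} → CL14bar F → ¬ CL14 F
exclusive (r-por _ ns _) (r-pand _ s _) = ns s
exclusive (r-por _ _ prem) (r-por {C} _ t e d) = exclusive (prem C _ _ _ t refl e) d
exclusive (r-por q _ _) (r-sand-cand nq _ _ _) = nq q
exclusive (r-por q _ _) (r-cor {C} _ _ _) with quasielementary-plug⁻ C q
... | op () _ _ _
exclusive (r-por q _ _) (r-sor {C} _ _) with quasielementary-plug⁻ C q
... | op () _ _ _
exclusive (r-pand {C} q t e d) cl = exclusive d (CL14-pand-admissible cl q (mv C t refl e refl))
exclusive (r-sor-cor nq _ _ _) (r-pand q _ _) = nq q
exclusive (r-sor-cor nq _ _ _) (r-por q _ _ _) = nq q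
exclusive (r-sor-cor _ dq _ _) (r-sand-cand _ d _ _) = exclusive dq d
exclusive (r-sor-cor _ _ prem _) (r-cor {C} t e d) = exclusive (prem C _ _ _ t refl e) d
exclusive (r-sor-cor _ _ _ prem) (r-sor {C} t d) = exclusive (prem C _ _ _ t refl) d
exclusive (r-cand {C} t e d) cl = exclusive d (CL14-environment-admissible cand cl (mv C t refl e refl))
exclusive (r-sand {C} t d) cl = exclusive d (CL14-environment-admissible sand cl (mv C t refl refl refl))

-- Decidability of the side conditions

code : Conn → ℕ
code and = 0
code or = 1
code pand = 2
code por = 3
code sand = 4
code sor = 5
code cand = 6
code cor = 7

decode : ℕ → Conn
decode 0 = and
decode 1 = or
decode 2 = pand
decode 3 = por
decode 4 = sand
decode 5 = sor
decode 6 = cand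
decode _ = cor

decode-code : ∀ c → decode (code c) ≡ c
decode-code and = refl
decode-code or = refl
decode-code pand = refl
decode-code por = refl
decode-code sand = refl
decode-code sor = refl
decode-code cand = refl
decode-code cor = refl

code-injective : ∀ {c d} → code c ≡ code d → c ≡ d
code-injective {c} {d} e = trans (sym (decode-code c)) (trans (cong decode e) (decode-code d))

_≟C_ : (c d : Conn) → Dec (c ≡ d)
c ≟C d = map′ code-injective (cong code) (code c ≟ code d)

surface? : Decidable SurfaceConn
surface? and = yes and
surface? or = yes or
surface? pand = no λ ()
surface? por = no λ ()
surface? sand = no λ ()
surface? sor = no λ ()
surface? cand = no λ ()
surface? cor = no λ ()

semisurface? : Decidable SemisurfaceConn
semisurface? and = yes and
semisurface? or = yes or
semisurface? pand = yes pand
semisurface? por = yes por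
semisurface? sand = yes sand
semisurface? sor = yes sor
semisurface? cand = no λ ()
semisurface? cor = no λ ()

qeConn? : Decidable QEConn
qeConn? and = yes and
qeConn? or = yes or
qeConn? pand = yes pand
qeConn? por = yes por
qeConn? sand = no λ ()
qeConn? sor = no λ ()
qeConn? cand = no λ ()
qeConn? cor = no λ ()

quasielementary-op? : ∀ {c E₁ E₂ Es} → Dec (QEConn c) → Dec (Quasielementary E₁) →
  Dec (Quasielementary E₂) → Dec (All Quasielementary Es) → Dec (Quasielementary (op c E₁ E₂ Es))
quasielementary-op? (yes k) (yes q₁) (yes q₂) (yes qs) = yes (op k q₁ q₂ qs)
quasielementary-op? (no ¬k) _ _ _ = no λ { (op k _ _ _) → ¬k k }
quasielementary-op? _ (no ¬q₁) _ _ = no λ { (op _ q₁ _ _) → ¬q₁ q₁ }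
quasielementary-op? _ _ (no ¬q₂) _ = no λ { (op _ _ q₂ _) → ¬q₂ q₂ }
quasielementary-op? _ _ _ (no ¬qs) = no λ { (op _ _ _ qs) → ¬qs qs }

mutual
  quasielementary? : Decidable Quasielementary
  quasielementary? (atom p) = yes atom
  quasielementary? (natom p) = yes natom
  quasielementary? ⊤f = yes ⊤f
  quasielementary? ⊥f = yes ⊥f
  quasielementary? (op c E₁ E₂ Es) =
    quasielementary-op? (qeConn? c) (quasielementary? E₁) (quasielementary? E₂) (all-quasielementary? Es)

  all-quasielementary? : Decidable (All Quasielementary)
  all-quasielementary? [] = yes []
  all-quasielementary? (E ∷ Es) with quasielementary? E | all-quasielementary? Es
  ... | yes q | yes qs = yes (q ∷ qs)
  ... | no ¬q | _ = no λ { (q ∷ _) → ¬q q }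
  ... | _ | no ¬qs = no λ { (_ ∷ qs) → ¬qs qs }

mutual
  atoms : Formula → List ℕ
  atoms (atom p) = [ p ]
  atoms (natom p) = [ p ]
  atoms ⊤f = []
  atoms ⊥f = []
  atoms (op c E₁ E₂ Es) = atoms E₁ ++ atoms E₂ ++ atomsList Es

  atomsList : List Formula → List ℕ
  atomsList [] = []
  atomsList (E ∷ Es) = atoms E ++ atomsList Es

AgreeOn : List ℕ → (ℕ → Bool) → (ℕ → Bool) → Set
AgreeOn L v w = ∀ {q} → q ∈ L → v q ≡ w q

agreeOn-++ˡ : ∀ {v w} L {M} → AgreeOn (L ++ M) v w → AgreeOn L v w
agreeOn-++ˡ L h q∈ = h (∈-++⁺ˡ q∈)

agreeOn-++ʳ : ∀ {v w} L {M} → AgreeOn (L ++ M) v w → AgreeOn M v w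
agreeOn-++ʳ L h q∈ = h (∈-++⁺ʳ L q∈)

mutual
  eval-cong : ∀ {v w} G → AgreeOn (atoms G) v w → eval v G ≡ eval w G
  eval-cong (atom p) h = h (here refl)
  eval-cong (natom p) h = cong not (h (here refl))
  eval-cong ⊤f h = refl
  eval-cong ⊥f h = refl
  eval-cong (op and E₁ E₂ Es) h =
    cong₂ Bool._∧_ (eval-cong E₁ (agreeOn-++ˡ (atoms E₁) h))
      (cong₂ Bool._∧_ (eval-cong E₂ (agreeOn-++ˡ (atoms E₂) (agreeOn-++ʳ (atoms E₁) h)))
                      (evalAll-cong Es (agreeOn-++ʳ (atoms E₂) (agreeOn-++ʳ (atoms E₁) h))))
  eval-cong (op or E₁ E₂ Es) h =
    cong₂ Bool._∨_ (eval-cong E₁ (agreeOn-++ˡ (atoms E₁) h))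
      (cong₂ Bool._∨_ (eval-cong E₂ (agreeOn-++ˡ (atoms E₂) (agreeOn-++ʳ (atoms E₁) h)))
                      (evalAny-cong Es (agreeOn-++ʳ (atoms E₂) (agreeOn-++ʳ (atoms E₁) h))))
  eval-cong (op pand E₁ E₂ Es) h = refl
  eval-cong (op por E₁ E₂ Es) h = refl
  eval-cong (op sand E₁ E₂ Es) h = refl
  eval-cong (op sor E₁ E₂ Es) h = refl
  eval-cong (op cand E₁ E₂ Es) h = refl
  eval-cong (op cor E₁ E₂ Es) h = refl

  evalAll-cong : ∀ {v w} Es → AgreeOn (atomsList Es) v w → evalAll v Es ≡ evalAll w Es
  evalAll-cong [] h = refl
  evalAll-cong (E ∷ Es) h =
    cong₂ Bool._∧_ (eval-cong E (agreeOn-++ˡ (atoms E) h)) (evalAll-cong Es (agreeOn-++ʳ (atoms E) h))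

  evalAny-cong : ∀ {v w} Es → AgreeOn (atomsList Es) v w → evalAny v Es ≡ evalAny w Es
  evalAny-cong [] h = refl
  evalAny-cong (E ∷ Es) h =
    cong₂ Bool._∨_ (eval-cong E (agreeOn-++ˡ (atoms E) h)) (evalAny-cong Es (agreeOn-++ʳ (atoms E) h))

update : (ℕ → Bool) → ℕ → Bool → ℕ → Bool
update v p b q with q ≟ p
... | yes _ = b
... | no _ = v q

update-≡ : ∀ v p b (w : ℕ → Bool) q → (q ≡ p → w q ≡ b) → (q ≢ p → w q ≡ v q) → w q ≡ update v p b q
update-≡ v p b w q at-p off-p with q ≟ p
... | yes q≡p = at-p q≡p
... | no q≢p = off-p q≢p

Falsifiable : Formula → Set
Falsifiable G = ∃[ w ] eval w G ≡ false

TrueAround : Formula → List ℕ → (ℕ → Bool) → Set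
TrueAround G L v = ∀ w → (∀ {q} → q ∈ atoms G → q ∉ L → w q ≡ v q) → eval w G ≡ true

falsifiable-or-true-around : ∀ G L v → Falsifiable G ⊎ TrueAround G L v
falsifiable-or-true-around G [] v with eval v G in eq
... | false = inj₁ (v , eq)
... | true = inj₂ λ w agree → trans (eval-cong G (λ q∈ → agree q∈ λ ())) eq
falsifiable-or-true-around G (p ∷ L) v
  with falsifiable-or-true-around G L (update v p true) | falsifiable-or-true-around G L (update v p false)
... | inj₁ f | _ = inj₁ f
... | inj₂ _ | inj₁ f = inj₁ f
... | inj₂ true-at-true | inj₂ true-at-false = inj₂ λ w agree → by-value-at-p w agree (w p) refl
  where
  true-around : ∀ b → TrueAround G L (update v p b)
  true-around true = true-at-true
  true-around false = true-at-false

  by-value-at-p : ∀ w → (∀ {q} → q ∈ atoms G → q ∉ p ∷ L → w q ≡ v q) → ∀ b → w p ≡ b →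
    eval w G ≡ true
  by-value-at-p w agree b wp≡b = true-around b w λ {q} q∈ q∉L →
    update-≡ v p b w q (λ { refl → wp≡b }) (λ q≢p → agree q∈ λ { (here e) → q≢p e ; (there e) → q∉L e })

tautology? : Decidable Tautology
tautology? G with falsifiable-or-true-around G (atoms G) (λ _ → false)
... | inj₁ (w , false≡) = no λ taut → true≢false (trans (sym (taut w)) false≡)
  where
  true≢false : true ≢ false
  true≢false ()
... | inj₂ true-around = yes λ w → true-around w λ q∈ q∉ → ⊥-elim (q∉ q∈)

mutual
  size : Formula → ℕ
  size (op c E₁ E₂ Es) = suc (size E₁ + (size E₂ + sizeList Es))
  size _ = 1

  sizeList : List Formula → ℕ
  sizeList [] = 0
  sizeList (E ∷ Es) = size E + sizeList Es

size-positive : ∀ F → 0 < size F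
size-positive (atom p) = s≤s z≤n
size-positive (natom p) = s≤s z≤n
size-positive ⊤f = s≤s z≤n
size-positive ⊥f = s≤s z≤n
size-positive (op c E₁ E₂ Es) = s≤s z≤n

size-∈ : ∀ {E Es} → E ∈ Es → size E ≤ sizeList Es
size-∈ (here refl) = m≤m+n _ _
size-∈ {Es = E' ∷ _} (there m) = ≤-trans (size-∈ m) (m≤n+m _ (size E'))

size-component : ∀ {c A₁ A₂ As E} → E ∈ A₁ ∷ A₂ ∷ As → size E < size (op c A₁ A₂ As)
size-component (here refl) = s≤s (m≤m+n _ _)
size-component {A₁ = A₁} {A₂} {As} (there (here refl)) =
  s≤s (≤-trans (m≤m+n (size A₂) (sizeList As)) (m≤n+m _ (size A₁)))
size-component {A₁ = A₁} {A₂} {As} (there (there m)) =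
  s≤s (≤-trans (size-∈ m) (≤-trans (m≤n+m (sizeList As) (size A₂)) (m≤n+m _ (size A₁))))

size-result : ∀ k {c A₁ A₂ As X'} → Result k c A₁ A₂ As X' → size X' < size (op c A₁ A₂ As)
size-result choice {c} X'∈ = size-component {c} X'∈
size-result tail {c} {A₁} {A₂} {[]} refl = size-component {c} {A₁} {A₂} {[]} (there (here refl))
size-result tail {A₁ = A₁} {As = _ ∷ _} refl = s≤s (m<n+m _ (size-positive A₁))

sizeList-< : ∀ bs {x y} as → size x < size y → sizeList (bs ++ x ∷ as) < sizeList (bs ++ y ∷ as)
sizeList-< [] as lt = +-monoˡ-< (sizeList as) lt
sizeList-< (b ∷ bs) as lt = +-monoʳ-< (size b) (sizeList-< bs as lt)

size-plug-< : ∀ C {X Y} → size X < size Y → size (plug C X) < size (plug C Y)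
size-plug-< hole lt = lt
size-plug-< (first c C E₂ Es) lt = s≤s (+-monoˡ-< _ (size-plug-< C lt))
size-plug-< (second c E₁ C Es) lt = s≤s (+-monoʳ-< (size E₁) (+-monoˡ-< _ (size-plug-< C lt)))
size-plug-< (later c E₁ E₂ bs C as) lt =
  s≤s (+-monoʳ-< (size E₁) (+-monoʳ-< (size E₂) (sizeList-< bs as (size-plug-< C lt))))

size-move : ∀ {P c k F G} → Move P c k F G → size G < size F
size-move {k = k} (mv C _ refl r refl) = size-plug-< C (size-result k r)

mutual
  size-qe-≤ : ∀ F → size (qe F) ≤ size F
  size-qe-≤ (atom p) = ≤-refl
  size-qe-≤ (natom p) = ≤-refl
  size-qe-≤ ⊤f = ≤-refl
  size-qe-≤ ⊥f = ≤-refl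
  size-qe-≤ (op and E₁ E₂ Es) = size-qe-≤-args and E₁ E₂ Es
  size-qe-≤ (op or E₁ E₂ Es) = size-qe-≤-args or E₁ E₂ Es
  size-qe-≤ (op pand E₁ E₂ Es) = size-qe-≤-args pand E₁ E₂ Es
  size-qe-≤ (op por E₁ E₂ Es) = size-qe-≤-args por E₁ E₂ Es
  size-qe-≤ (op sand E₁ E₂ Es) = ≤-trans (size-qe-≤ E₁) (<⇒≤ (size-component {sand} {E₁} {E₂} {Es} (here refl)))
  size-qe-≤ (op sor E₁ E₂ Es) = ≤-trans (size-qe-≤ E₁) (<⇒≤ (size-component {sor} {E₁} {E₂} {Es} (here refl)))
  size-qe-≤ (op cand E₁ E₂ Es) = s≤s z≤n
  size-qe-≤ (op cor E₁ E₂ Es) = s≤s z≤n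

  size-qe-≤-args : ∀ k E₁ E₂ Es → size (op k (qe E₁) (qe E₂) (qeList Es)) ≤ size (op k E₁ E₂ Es)
  size-qe-≤-args k E₁ E₂ Es = s≤s (+-mono-≤ (size-qe-≤ E₁) (+-mono-≤ (size-qe-≤ E₂) (sizeList-qeList-≤ Es)))

  sizeList-qeList-≤ : ∀ Es → sizeList (qeList Es) ≤ sizeList Es
  sizeList-qeList-≤ [] = z≤n
  sizeList-qeList-≤ (E ∷ Es) = +-mono-≤ (size-qe-≤ E) (sizeList-qeList-≤ Es)

-- a₁, a₂, aL are the sizes of the quasielementarized components.
quasielementary-or-<-op : ∀ {k E₁ E₂ Es a₁ a₂ aL} → QEConn k →
  a₁ ≤ size E₁ → a₂ ≤ size E₂ → aL ≤ sizeList Es →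
  Quasielementary E₁ ⊎ a₁ < size E₁ → Quasielementary E₂ ⊎ a₂ < size E₂ →
  All Quasielementary Es ⊎ aL < sizeList Es →
  Quasielementary (op k E₁ E₂ Es) ⊎ suc (a₁ + (a₂ + aL)) < size (op k E₁ E₂ Es)
quasielementary-or-<-op k _ _ _ (inj₁ q₁) (inj₁ q₂) (inj₁ qs) = inj₁ (op k q₁ q₂ qs)
quasielementary-or-<-op k _ ≤₂ ≤L (inj₂ <₁) _ _ = inj₂ (s≤s (+-mono-<-≤ <₁ (+-mono-≤ ≤₂ ≤L)))
quasielementary-or-<-op k ≤₁ _ ≤L (inj₁ _) (inj₂ <₂) _ = inj₂ (s≤s (+-mono-≤-< ≤₁ (+-mono-<-≤ <₂ ≤L)))
quasielementary-or-<-op k ≤₁ ≤₂ _ (inj₁ _) (inj₁ _) (inj₂ <L) = inj₂ (s≤s (+-mono-≤-< ≤₁ (+-mono-≤-< ≤₂ <L)))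

mutual
  quasielementary-or-size-qe-< : ∀ F → Quasielementary F ⊎ size (qe F) < size F
  quasielementary-or-size-qe-< (atom p) = inj₁ atom
  quasielementary-or-size-qe-< (natom p) = inj₁ natom
  quasielementary-or-size-qe-< ⊤f = inj₁ ⊤f
  quasielementary-or-size-qe-< ⊥f = inj₁ ⊥f
  quasielementary-or-size-qe-< (op and E₁ E₂ Es) = quasielementary-or-size-qe-<-args and E₁ E₂ Es
  quasielementary-or-size-qe-< (op or E₁ E₂ Es) = quasielementary-or-size-qe-<-args or E₁ E₂ Es
  quasielementary-or-size-qe-< (op pand E₁ E₂ Es) = quasielementary-or-size-qe-<-args pand E₁ E₂ Es
  quasielementary-or-size-qe-< (op por E₁ E₂ Es) = quasielementary-or-size-qe-<-args por E₁ E₂ Es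
  quasielementary-or-size-qe-< (op sand E₁ E₂ Es) =
    inj₂ (≤-<-trans (size-qe-≤ E₁) (size-component {sand} {E₁} {E₂} {Es} (here refl)))
  quasielementary-or-size-qe-< (op sor E₁ E₂ Es) =
    inj₂ (≤-<-trans (size-qe-≤ E₁) (size-component {sor} {E₁} {E₂} {Es} (here refl)))
  quasielementary-or-size-qe-< (op cand E₁ E₂ Es) = inj₂ (s≤s (≤-trans (size-positive E₁) (m≤m+n _ _)))
  quasielementary-or-size-qe-< (op cor E₁ E₂ Es) = inj₂ (s≤s (≤-trans (size-positive E₁) (m≤m+n _ _)))

  quasielementary-or-size-qe-<-args : ∀ {k} → QEConn k → ∀ E₁ E₂ Es →
    Quasielementary (op k E₁ E₂ Es) ⊎ size (op k (qe E₁) (qe E₂) (qeList Es)) < size (op k E₁ E₂ Es)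
  quasielementary-or-size-qe-<-args k E₁ E₂ Es =
    quasielementary-or-<-op k (size-qe-≤ E₁) (size-qe-≤ E₂) (sizeList-qeList-≤ Es)
      (quasielementary-or-size-qe-< E₁) (quasielementary-or-size-qe-< E₂) (all-quasielementary-or-< Es)

  all-quasielementary-or-< : ∀ Es → All Quasielementary Es ⊎ sizeList (qeList Es) < sizeList Es
  all-quasielementary-or-< [] = inj₁ []
  all-quasielementary-or-< (E ∷ Es) with quasielementary-or-size-qe-< E | all-quasielementary-or-< Es
  ... | inj₁ q | inj₁ qs = inj₁ (q ∷ qs)
  ... | inj₂ lt | _ = inj₂ (+-mono-<-≤ lt (sizeList-qeList-≤ Es))
  ... | inj₁ _ | inj₂ lt = inj₂ (+-mono-≤-< (size-qe-≤ E) lt)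

size-qe-< : ∀ F → ¬ Quasielementary F → size (qe F) < size F
size-qe-< F ¬q = [ (λ q → ⊥-elim (¬q q)) , id ]′ (quasielementary-or-size-qe-< F)

-- Enumerating occurrences

all-or-some : ∀ {X : Set} {A B : X → Set} (xs : List X) → (∀ {x} → x ∈ xs → A x ⊎ B x) →
  (∀ {x} → x ∈ xs → A x) ⊎ ∃[ x ] (x ∈ xs × B x)
all-or-some [] f = inj₁ λ ()
all-or-some (x ∷ xs) f with f (here refl) | all-or-some xs (λ m → f (there m))
... | inj₂ b | _ = inj₂ (x , here refl , b)
... | inj₁ a | inj₁ as = inj₁ λ { (here refl) → a ; (there m) → as m }
... | inj₁ _ | inj₂ (y , m , b) = inj₂ (y , there m , b)

record Occurrence : Set where
  constructor occurrence
  field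
    context : Ctx
    arg₁ arg₂ : Formula
    args : List Formula

open Occurrence

module Occurrences {P : Conn → Set} (P? : Decidable P) (c : Conn) where

  redex : Occurrence → Formula
  redex o = op c (arg₁ o) (arg₂ o) (args o)

  Valid : Formula → Occurrence → Set
  Valid F o = Through P (context o) × F ≡ plug (context o) (redex o)

  under : (Ctx → Ctx) → Occurrence → Occurrence
  under w o = record o { context = w (context o) }

  self : ∀ {c₀} → Dec (c₀ ≡ c) → Formula → Formula → List Formula → List Occurrence
  self (yes _) E₁ E₂ Es = [ occurrence hole E₁ E₂ Es ]
  self (no _) E₁ E₂ Es = []

  mutual
    occurrences : Formula → List Occurrence
    occurrences (op c₀ E₁ E₂ Es) = self (c₀ ≟C c) E₁ E₂ Es ++ below (P? c₀) E₁ E₂ Es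
    occurrences _ = []

    below : ∀ {c₀} → Dec (P c₀) → Formula → Formula → List Formula → List Occurrence
    below {c₀} (yes _) E₁ E₂ Es =
      map (under λ K → first c₀ K E₂ Es) (occurrences E₁) ++
      map (under λ K → second c₀ E₁ K Es) (occurrences E₂) ++
      occurrencesList c₀ E₁ E₂ [] Es
    below (no _) E₁ E₂ Es = []

    occurrencesList : Conn → Formula → Formula → List Formula → List Formula → List Occurrence
    occurrencesList c₀ E₁ E₂ bs [] = []
    occurrencesList c₀ E₁ E₂ bs (x ∷ as) =
      map (under λ K → later c₀ E₁ E₂ bs K as) (occurrences x) ++ occurrencesList c₀ E₁ E₂ (bs ++ [ x ]) as

  mutual
    occurrences-sound : ∀ F {o} → o ∈ occurrences F → Valid F o
    occurrences-sound (op c₀ E₁ E₂ Es) m with ∈-++⁻ (self (c₀ ≟C c) E₁ E₂ Es) m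
    ... | inj₁ m' = self-sound (c₀ ≟C c) m'
    ... | inj₂ m' = below-sound (P? c₀) m'

    self-sound : ∀ {c₀ E₁ E₂ Es o} (c₀≟c : Dec (c₀ ≡ c)) → o ∈ self c₀≟c E₁ E₂ Es →
      Valid (op c₀ E₁ E₂ Es) o
    self-sound (yes refl) (here refl) = hole , refl

    below-sound : ∀ {c₀ E₁ E₂ Es o} (p? : Dec (P c₀)) → o ∈ below p? E₁ E₂ Es → Valid (op c₀ E₁ E₂ Es) o
    below-sound {c₀} {E₁} {E₂} {Es} (yes p) m with ∈-++⁻ (map (under λ K → first c₀ K E₂ Es) (occurrences E₁)) m
    ... | inj₁ m₁ with ∈-map⁻ (under λ K → first c₀ K E₂ Es) m₁
    ...   | o' , m' , refl with occurrences-sound E₁ m'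
    ...     | t , e = first p t , cong (λ x → op c₀ x E₂ Es) e
    below-sound {c₀} {E₁} {E₂} {Es} (yes p) m | inj₂ m₂
      with ∈-++⁻ (map (under λ K → second c₀ E₁ K Es) (occurrences E₂)) m₂
    ... | inj₁ m₁ with ∈-map⁻ (under λ K → second c₀ E₁ K Es) m₁
    ...   | o' , m' , refl with occurrences-sound E₂ m'
    ...     | t , e = second p t , cong (λ x → op c₀ E₁ x Es) e
    below-sound (yes p) m | inj₂ m₂ | inj₂ m₃ = occurrencesList-sound [] _ p m₃

    occurrencesList-sound : ∀ {c₀ E₁ E₂ o} bs as → P c₀ → o ∈ occurrencesList c₀ E₁ E₂ bs as →
      Valid (op c₀ E₁ E₂ (bs ++ as)) o
    occurrencesList-sound {c₀} {E₁} {E₂} bs (x ∷ as) p m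
      with ∈-++⁻ (map (under λ K → later c₀ E₁ E₂ bs K as) (occurrences x)) m
    ... | inj₁ m₁ with ∈-map⁻ (under λ K → later c₀ E₁ E₂ bs K as) m₁
    ...   | o' , m' , refl with occurrences-sound x m'
    ...     | t , e = later p t , cong (λ y → op c₀ E₁ E₂ (bs ++ y ∷ as)) e
    occurrencesList-sound {c₀} {E₁} {E₂} {o} bs (x ∷ as) p m | inj₂ m₂ =
      subst (λ z → Valid (op c₀ E₁ E₂ z) o) (++-assoc bs [ x ] as) (occurrencesList-sound (bs ++ [ x ]) as p m₂)

  mutual
    occurrences-complete : ∀ C {A₁ A₂ As} → Through P C →
      occurrence C A₁ A₂ As ∈ occurrences (plug C (op c A₁ A₂ As))
    occurrences-complete hole hole with c ≟C c
    ... | yes refl = here refl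
    ... | no c≢c = ⊥-elim (c≢c refl)
    occurrences-complete (first c₀ C E₂ Es) (first p t) with P? c₀
    ... | yes _ = ∈-++⁺ʳ (self (c₀ ≟C c) _ E₂ Es)
                    (∈-++⁺ˡ (∈-map⁺ (under λ K → first c₀ K E₂ Es) (occurrences-complete C t)))
    ... | no ¬p = ⊥-elim (¬p p)
    occurrences-complete (second c₀ E₁ C Es) (second p t) with P? c₀
    ... | yes _ = ∈-++⁺ʳ (self (c₀ ≟C c) E₁ _ Es)
                    (∈-++⁺ʳ (map (under λ K → first c₀ K _ Es) (occurrences E₁))
                      (∈-++⁺ˡ (∈-map⁺ (under λ K → second c₀ E₁ K Es) (occurrences-complete C t))))
    ... | no ¬p = ⊥-elim (¬p p)
    occurrences-complete (later c₀ E₁ E₂ bs C as) (later p t) with P? c₀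
    ... | yes _ = ∈-++⁺ʳ (self (c₀ ≟C c) E₁ E₂ _)
                    (∈-++⁺ʳ (map (under λ K → first c₀ K E₂ _) (occurrences E₁))
                      (∈-++⁺ʳ (map (under λ K → second c₀ E₁ K _) (occurrences E₂))
                        (occurrencesList-complete c₀ E₁ E₂ [] bs C as t)))
    ... | no ¬p = ⊥-elim (¬p p)

    occurrencesList-complete : ∀ c₀ E₁ E₂ pre bs C as {A₁ A₂ As} → Through P C →
      occurrence (later c₀ E₁ E₂ (pre ++ bs) C as) A₁ A₂ As ∈
        occurrencesList c₀ E₁ E₂ pre (bs ++ plug C (op c A₁ A₂ As) ∷ as)
    occurrencesList-complete c₀ E₁ E₂ pre [] C as t
      rewrite ++-identityʳ pre =
      ∈-++⁺ˡ (∈-map⁺ (under λ K → later c₀ E₁ E₂ pre K as) (occurrences-complete C t))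
    occurrencesList-complete c₀ E₁ E₂ pre (b ∷ bs) C as {A₁} {A₂} {As} t
      rewrite sym (++-assoc pre [ b ] bs) =
      ∈-++⁺ʳ (map (under λ K → later c₀ E₁ E₂ pre K (bs ++ plug C (op c A₁ A₂ As) ∷ as)) (occurrences b))
             (occurrencesList-complete c₀ E₁ E₂ (pre ++ [ b ]) bs C as t)

  ResultAt : Kind → Occurrence → Formula → Set
  ResultAt k o = Result k c (arg₁ o) (arg₂ o) (args o)

  occurrence-move : ∀ {k F o X'} → o ∈ occurrences F → ResultAt k o X' → Move P c k F (plug (context o) X')
  occurrence-move {F = F} {o} m r with occurrences-sound F m
  ... | t , e = mv (context o) t e r refl

  results-dec : ∀ {A B : Formula → Set} k o →
    (∀ {X'} → ResultAt k o X' → A X' ⊎ B X') →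
    (∀ {X'} → ResultAt k o X' → A X') ⊎ ∃[ X' ] (ResultAt k o X' × B X')
  results-dec choice o f = all-or-some (arg₁ o ∷ arg₂ o ∷ args o) f
  results-dec tail o f with f refl
  ... | inj₁ a = inj₁ λ { refl → a }
  ... | inj₂ b = inj₂ (_ , refl , b)

  moves-dec : ∀ {A B : Formula → Set} k F → (∀ {G} → size G < size F → A G ⊎ B G) →
    (∀ {G} → Move P c k F G → A G) ⊎ ∃[ G ] (Move P c k F G × B G)
  moves-dec {A} {B} k F dec
    with all-or-some {A = λ o → ∀ {X'} → ResultAt k o X' → A (plug (context o) X')}
                     {B = λ o → ∃[ X' ] (ResultAt k o X' × B (plug (context o) X'))}
                     (occurrences F)
                     (λ {o} m → results-dec k o λ r → dec (size-move (occurrence-move m r)))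
  ... | inj₁ all = inj₁ λ { (mv C t refl r refl) → all (occurrences-complete C t) r }
  ... | inj₂ (_ , m , _ , r , b) = inj₂ (_ , occurrence-move m r , b)

open Occurrences using (moves-dec)

-- Totality

total-step : ∀ F → (∀ {G} → size G < size F → CL14 G ⊎ CL14bar G) → CL14 F ⊎ CL14bar F
total-step F ih with quasielementary? F
total-step F ih | yes q with tautology? (elem F)
total-step F ih | yes q | yes s with moves-dec surface? pand choice F ih
... | inj₁ all = inj₁ (r-pand q s (all-choices all))
... | inj₂ (_ , m , d) = inj₂ (CL14bar-pand-move m q d)
total-step F ih | yes q | no ¬s with moves-dec surface? por choice F (λ lt → swap (ih lt))
... | inj₁ all = inj₂ (r-por q ¬s (all-choices all))
... | inj₂ (_ , m , d) = inj₁ (CL14-por-move m q d)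
total-step F ih | no ¬q
  with moves-dec semisurface? cand choice F ih | moves-dec semisurface? sand tail F ih
... | inj₂ (_ , m , d) | _ = inj₂ (CL14bar-environment-move cand m d)
... | _ | inj₂ (_ , m , d) = inj₂ (CL14bar-environment-move sand m d)
... | inj₁ cands | inj₁ sands with ih (size-qe-< F ¬q)
...   | inj₁ d = inj₁ (r-sand-cand ¬q d (all-choices cands) (all-tails sands))
...   | inj₂ d
  with moves-dec semisurface? cor choice F (λ lt → swap (ih lt))
     | moves-dec semisurface? sor tail F (λ lt → swap (ih lt))
...     | inj₂ (_ , m , d') | _ = inj₁ (CL14-machine-move cor m d')
...     | _ | inj₂ (_ , m , d') = inj₁ (CL14-machine-move sor m d')
...     | inj₁ cors | inj₁ sors = inj₂ (r-sor-cor ¬q d (all-choices cors) (all-tails sors))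

total : ∀ F → CL14 F ⊎ CL14bar F
total = WellFounded.All.wfRec (wellFounded size <-wellFounded) 0ℓ (λ F → CL14 F ⊎ CL14bar F) total-step

lemma6p3 : ∀ (F : Formula) → (¬ CL14 F → CL14bar F) × (CL14bar F → ¬ CL14 F)
lemma6p3 F = (λ ⊬F → [ (λ ⊢F → ⊥-elim (⊬F ⊢F)) , id ]′ (total F)) , exclusive
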